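{- Fix a universe $U$ of items and an ordering $\pi$ of $U$. Let $r=r_1\dots r_n$ and $r'=r'_1\dots r'_n$ be two request sequences over $U$ of equal length $n$. For each $t$, let $\rho_t$ be the rank of $r_t$ in the prefix $r_1\dots r_{t-1}$ and $\rho'_t$ the rank of $r'_t$ in $r'_1\dots r'_{t-1}$. If $\rho_t\ge\rho'_t$ for all $t=1,\dots,n$, then $\mathrm{Opt}(r)\ge\mathrm{Opt}(r')$.
   Context: The rank of an item $x\in U$ in a sequence $s$ (with respect to $\pi$) is its position in the following ordering of $U$: first the items requested in $s$, ordered by most recent request (most recently requested item has rank 1); then the items not requested in $s$, ordered by $\pi$. Paging with cache size $k$: a schedule for $s_1\dots s_n$ is a sequence of sets $S_1\dots S_n$ with $|S_t|\le k$ and $s_t\in S_t$; its cost is the number of evictions (items in $S_{t-1}$ but not in $S_t$); $\mathrm{Opt}(s)$ is the minimum cost of a schedule for $s$. -}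

module Defs where

open import Data.Nat using (ℕ; zero; suc; _+_; _≤_)
open import Data.Fin using (Fin; _≟_)
open import Data.Fin.Subset using (Subset; _∈_; _─_; ∣_∣)
open import Data.Fin.Permutation using (Permutation′; _⟨$⟩ʳ_)
open import Data.List using (List; []; _∷_; _++_; [_]; map; filter; reverse; deduplicate; allFin)
open import Data.List.Membership.DecPropositional using ()
open import Relation.Binary.PropositionalEquality using (_≡_)
open import Data.List.Relation.Binary.Pointwise using (Pointwise)
open import Data.Product using (_×_; Σ; _,_)
open import Relation.Nullary using (¬?; yes; no)

-- The universe U is Fin N; the ordering π lists the items as
-- π ⟨$⟩ʳ 0, π ⟨$⟩ʳ 1, ..., π ⟨$⟩ʳ (N-1).
module _ {N : ℕ} (π : Permutation′ N) where

  open Data.List.Membership.DecPropositional (_≟_ {n = N}) using (_∈?_)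

  -- The ordering of U w.r.t. a sequence s: requested items by most recent
  -- request first, then unrequested items in π-order.
  rankOrder : List (Fin N) → List (Fin N)
  rankOrder s = deduplicate _≟_ (reverse s)
                ++ filter (λ x → ¬? (x ∈? s)) (map (π ⟨$⟩ʳ_) (allFin N))

  -- 1-based position of x in a list
  position : Fin N → List (Fin N) → ℕ
  position x [] = 1
  position x (y ∷ ys) with x ≟ y
  ... | yes _ = 1
  ... | no _ = suc (position x ys)

  rank : Fin N → List (Fin N) → ℕ
  rank x s = position x (rankOrder s)

  ranksFrom : List (Fin N) → List (Fin N) → List ℕ
  ranksFrom p [] = []
  ranksFrom p (x ∷ xs) = rank x p ∷ ranksFrom (p ++ [ x ]) xs

  prefixRanks : List (Fin N) → List ℕ
  prefixRanks = ranksFrom []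

module _ {N : ℕ} where

  IsSchedule : ℕ → List (Fin N) → List (Subset N) → Set
  IsSchedule k s S = Pointwise (λ x C → x ∈ C × ∣ C ∣ ≤ k) s S

  -- number of evictions: Σ_t |S_{t-1} \ S_t| (initial cache empty)
  cost : List (Subset N) → ℕ
  cost [] = 0
  cost (C ∷ []) = 0
  cost (C ∷ D ∷ Cs) = ∣ C ─ D ∣ + cost (D ∷ Cs)

  IsOpt : ℕ → List (Fin N) → ℕ → Set
  IsOpt k s c = Σ (List (Subset N)) (λ S → IsSchedule k s S × cost S ≡ c)
              × (∀ S → IsSchedule k s S → c ≤ cost S)

-- The requests of r are lowered one rank step at a time.  Suppose that after the prefix p the
-- item x has rank j + 2 and y is the item of rank j + 1.  Request y instead of x and exchange
-- x and y in all later requests (the transposition τ).  The rank order after p y is the τ-image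
-- of the one after p x, so all later ranks stay the same.  The new sequence is no harder than
-- the old one: if neither x nor y occurs in p it is the τ-image of the old one, and otherwise
-- y was requested after the last request of x, so a schedule for the old sequence can be
-- followed as long as it keeps y cached and replaced by its τ-image from then on.  Iterating,
-- every request of r is lowered to the rank of the matching request of r′; as equal ranks after
-- equal prefixes name equal items, this turns r into r′ without ever increasing Opt.

module Submission where

open import Data.Bool.Base using (Bool; true; false; not; _∧_)
open import Data.Bool.Properties using (∧-zeroʳ; ∧-identityʳ)
open import Data.Fin.Base using (Fin; zero; suc)
open import Data.Fin.Permutation using (Permutation′; _⟨$⟩ʳ_; _⟨$⟩ˡ_; inverseʳ)
open import Data.Fin.Permutation.Components using (transpose)
open import Data.Fin.Properties using (_≟_)
open import Data.Fin.Subset using (Subset; _─_; ∣_∣) renaming (_∈_ to _∈ₛ_)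
open import Data.Fin.Subset.Properties using (p⊆q⇒∣p∣≤∣q∣)
open import Data.List.Base using (List; []; _∷_; _++_; [_]; map; filter; reverse; deduplicate; allFin; length)
open import Data.List.Membership.Propositional using (_∈_; _∉_)
open import Data.List.Membership.Propositional.Properties
  using (∈-++⁺ˡ; ∈-++⁺ʳ; ∈-++⁻; ∈-filter⁺; ∈-map⁺; ∈-allFin)
import Data.List.Membership.DecPropositional as DecMembership
open import Data.List.Properties
  using (map-++; ++-assoc; ++-identityʳ; filter-accept; filter-reject; filter-≐; filter-++; filter-all; reverse-++)
open import Data.List.Relation.Binary.Pointwise using (Pointwise; []; _∷_)
import Data.List.Relation.Binary.Pointwise as PW
import Data.List.Relation.Unary.All as All
open import Data.List.Relation.Unary.All.Properties using (All¬⇒¬Any; ¬Any⇒All¬; all-filter; ++⁻ʳ)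
open import Data.List.Relation.Unary.AllPairs using ([]; _∷_)
open import Data.List.Relation.Unary.Any using (here; there; tail)
open import Data.List.Relation.Unary.Unique.Propositional using (Unique)
import Data.List.Relation.Unary.Unique.Propositional.Properties as Unique
open import Data.List.Reverse using (Reverse; []; _∶_∶ʳ_; reverseView)
open import Data.Nat.Base using (ℕ; zero; suc; _+_; _≤_; _<_; _≥_; _∸_; z≤n; s≤s)
open import Data.Nat.Properties
  using (+-assoc; +-identityʳ; +-suc; +-cancelʳ-≡; +-mono-≤; +-monoʳ-≤; m∸n+n≡m; suc-injective;
         ≤-refl; ≤-reflexive; ≤-trans; ≤-pred; <-irrefl; <-asym; module ≤-Reasoning)
open import Data.Nat.Tactic.RingSolver using (solve-∀)
open import Data.Product.Base using (∃; ∃₂; _×_; _,_; proj₁; proj₂)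
open import Data.Sum.Base using (_⊎_; inj₁; inj₂)
open import Data.Vec.Base using (Vec; []; _∷_; lookup; tabulate; _[_]≔_)
open import Data.Vec.Properties
  using (lookup∘tabulate; tabulate∘lookup; tabulate-cong; lookup∘update; lookup∘update′;
         []=⇒lookup; lookup⇒[]=)
open import Function.Base using (_∘_)
open import Function.Bundles using (Injection)
open import Function.Definitions using (Injective)
open import Function.Properties.Inverse using (Inverse⇒Injection)
open import Relation.Binary.Core using (REL)
open import Relation.Binary.Definitions using (DecidableEquality)
open import Relation.Binary.PropositionalEquality
  using (_≡_; _≢_; _≗_; refl; sym; trans; cong; cong₂; subst; subst₂; module ≡-Reasoning)
open import Relation.Nullary using (Dec; yes; no; ¬?; contradiction)
open import Relation.Nullary.Decidable using (dec-true; dec-false)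
open import Relation.Unary using (Pred; Decidable)
open import Relation.Unary.Properties using (_∩?_)

open import Defs

bit : Bool → ℕ
bit true  = 1
bit false = 0

∣b∷p∣≡ : ∀ {n} b (p : Subset n) → ∣ b ∷ p ∣ ≡ bit b + ∣ p ∣
∣b∷p∣≡ true  p = refl
∣b∷p∣≡ false p = refl

≗-lookup⇒≡ : ∀ {a} {A : Set a} {n} {u v : Vec A n} → (∀ i → lookup u i ≡ lookup v i) → u ≡ v
≗-lookup⇒≡ {u = u} {v} eq = trans (sym (tabulate∘lookup u)) (trans (tabulate-cong eq) (tabulate∘lookup v))

lookup-─ : ∀ {n} (p q : Subset n) i → lookup (p ─ q) i ≡ lookup p i ∧ not (lookup q i)
lookup-─ (a ∷ p) (true  ∷ q) zero    = sym (∧-zeroʳ a)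
lookup-─ (a ∷ p) (false ∷ q) zero    = sym (∧-identityʳ a)
lookup-─ (a ∷ p) (b     ∷ q) (suc i) = lookup-─ p q i

lookup-⊆⇒∣p∣≤∣q∣ : ∀ {n} (p q : Subset n) → (∀ i → lookup p i ≡ true → lookup q i ≡ true) →
  ∣ p ∣ ≤ ∣ q ∣
lookup-⊆⇒∣p∣≤∣q∣ p q p⊆q =
  p⊆q⇒∣p∣≤∣q∣ {p = p} {q} λ i∈p → lookup⇒[]= _ q (p⊆q _ ([]=⇒lookup i∈p))

+-swap-outer : ∀ a m c → a + m + c ≡ c + m + a
+-swap-outer = solve-∀

∣p[i]≔b∣ : ∀ {n} (p : Subset n) i b → ∣ p [ i ]≔ b ∣ + bit (lookup p i) ≡ ∣ p ∣ + bit b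
∣p[i]≔b∣ (c ∷ p) zero b = begin
  ∣ b ∷ p ∣ + bit c    ≡⟨ cong (_+ bit c) (∣b∷p∣≡ b p) ⟩
  bit b + ∣ p ∣ + bit c ≡⟨ +-swap-outer (bit b) ∣ p ∣ (bit c) ⟩
  bit c + ∣ p ∣ + bit b ≡⟨ cong (_+ bit b) (∣b∷p∣≡ c p) ⟨
  ∣ c ∷ p ∣ + bit b    ∎
  where open ≡-Reasoning
∣p[i]≔b∣ (c ∷ p) (suc i) b = begin
  ∣ c ∷ p [ i ]≔ b ∣ + bit (lookup p i)
    ≡⟨ cong (_+ bit (lookup p i)) (∣b∷p∣≡ c (p [ i ]≔ b)) ⟩
  bit c + ∣ p [ i ]≔ b ∣ + bit (lookup p i)   ≡⟨ +-assoc (bit c) _ _ ⟩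
  bit c + (∣ p [ i ]≔ b ∣ + bit (lookup p i)) ≡⟨ cong (bit c +_) (∣p[i]≔b∣ p i b) ⟩
  bit c + (∣ p ∣ + bit b)                     ≡⟨ +-assoc (bit c) _ _ ⟨
  bit c + ∣ p ∣ + bit b                       ≡⟨ cong (_+ bit b) (∣b∷p∣≡ c p) ⟨
  ∣ c ∷ p ∣ + bit b                           ∎
  where open ≡-Reasoning

preimage : ∀ {n} → (Fin n → Fin n) → Subset n → Subset n
preimage f p = tabulate (lookup p ∘ f)

module _ {n : ℕ} (f : Fin n → Fin n) where

  lookup-preimage : ∀ p i → lookup (preimage f p) i ≡ lookup p (f i)
  lookup-preimage p = lookup∘tabulate (lookup p ∘ f)

  preimage-─ : ∀ p q → preimage f (p ─ q) ≡ preimage f p ─ preimage f q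
  preimage-─ p q = ≗-lookup⇒≡ λ i → begin
    lookup (preimage f (p ─ q)) i
      ≡⟨ lookup-preimage (p ─ q) i ⟩
    lookup (p ─ q) (f i)
      ≡⟨ lookup-─ p q (f i) ⟩
    lookup p (f i) ∧ not (lookup q (f i))
      ≡⟨ cong₂ (λ a b → a ∧ not b) (lookup-preimage p i) (lookup-preimage q i) ⟨
    lookup (preimage f p) i ∧ not (lookup (preimage f q) i)
      ≡⟨ lookup-─ (preimage f p) (preimage f q) i ⟨
    lookup (preimage f p ─ preimage f q) i
      ∎
    where open ≡-Reasoning

  preimage-invariant : ∀ p → (∀ i → lookup p (f i) ≡ lookup p i) → preimage f p ≡ p
  preimage-invariant p inv = ≗-lookup⇒≡ λ i → trans (lookup-preimage p i) (inv i)

filter-∩ : ∀ {a p q} {A : Set a} {P : Pred A p} {Q : Pred A q} (P? : Decidable P) (Q? : Decidable Q) →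
  filter (P? ∩? Q?) ≗ filter P? ∘ filter Q?
filter-∩ P? Q? []       = refl
filter-∩ {P = P} {Q} P? Q? (x ∷ xs) = by-cases (P? x) (Q? x)
  where
  ih : filter (P? ∩? Q?) xs ≡ filter P? (filter Q? xs)
  ih = filter-∩ P? Q? xs
  by-cases : Dec (P x) → Dec (Q x) → filter (P? ∩? Q?) (x ∷ xs) ≡ filter P? (filter Q? (x ∷ xs))
  by-cases (yes Px) (yes Qx) = trans (filter-accept (P? ∩? Q?) (Px , Qx))
    (trans (cong (x ∷_) ih) (sym (trans (cong (filter P?) (filter-accept Q? Qx)) (filter-accept P? Px))))
  by-cases (no ¬Px) (yes Qx) = trans (filter-reject (P? ∩? Q?) (¬Px ∘ proj₁))
    (trans ih (sym (trans (cong (filter P?) (filter-accept Q? Qx)) (filter-reject P? ¬Px))))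
  by-cases _        (no ¬Qx) = trans (filter-reject (P? ∩? Q?) (¬Qx ∘ proj₂))
    (trans ih (sym (cong (filter P?) (filter-reject Q? ¬Qx))))

Unique-++⁻ : ∀ {a} {A : Set a} (xs : List A) {ys} → Unique (xs ++ ys) →
  Unique ys × (∀ {z} → z ∈ xs → z ∉ ys)
Unique-++⁻ []       u          = u , λ ()
Unique-++⁻ (x ∷ xs) (x∉ ∷ u) with u′ , disjoint ← Unique-++⁻ xs u =
  u′ , λ { (here refl) → All¬⇒¬Any (++⁻ʳ xs x∉) ; (there z∈xs) → disjoint z∈xs }

Unique-adjacent : ∀ {a} {A : Set a} {x y : A} L R → Unique (L ++ y ∷ x ∷ R) →
  x ≢ y × x ∉ L × y ∉ L × x ∉ R × y ∉ R
Unique-adjacent L R unique with (y∉x∷R ∷ x∉R ∷ _) , disjoint ← Unique-++⁻ L unique =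
  (λ x≡y → All.head y∉x∷R (sym x≡y)) ,
  (λ x∈L → disjoint x∈L (there (here refl))) ,
  (λ y∈L → disjoint y∈L (here refl)) ,
  All¬⇒¬Any x∉R ,
  All¬⇒¬Any (All.tail y∉x∷R)

module _ {a} {A : Set a} (_≟ᴬ_ : DecidableEquality A) where

  open DecMembership _≟ᴬ_ using (_∈?_)

  last-occurrence : ∀ {w} p → w ∈ p → ∃₂ λ p₁ p₂ → p ≡ p₁ ++ w ∷ p₂ × w ∉ p₂
  last-occurrence {w} (u ∷ p) w∈ with w ∈? p
  ... | yes w∈p with p₁ , p₂ , p≡ , w∉p₂ ← last-occurrence p w∈p =
    u ∷ p₁ , p₂ , cong (u ∷_) p≡ , w∉p₂
  last-occurrence (u ∷ p) (here refl) | no w∉p = [] , p , refl , w∉p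
  last-occurrence (u ∷ p) (there w∈p) | no w∉p = contradiction w∈p w∉p

module _ {a b ℓ} {A : Set a} {B : Set b} {R : REL A B ℓ} where

  Pointwise-++⁻ : ∀ xs {ys} zs → Pointwise R (xs ++ ys) zs →
    ∃₂ λ zs₁ zs₂ → zs ≡ zs₁ ++ zs₂ × Pointwise R xs zs₁ × Pointwise R ys zs₂
  Pointwise-++⁻ []       zs       rs       = [] , zs , refl , [] , rs
  Pointwise-++⁻ (x ∷ xs) (z ∷ zs) (r ∷ rs)
    with zs₁ , zs₂ , refl , rs₁ , rs₂ ← Pointwise-++⁻ xs zs rs =
    z ∷ zs₁ , zs₂ , refl , r ∷ rs₁ , rs₂

module _ {N : ℕ} where

  Easier : ℕ → List (Fin N) → List (Fin N) → Set
  Easier k r′ r = ∀ S → IsSchedule k r S → ∃ λ S′ → IsSchedule k r′ S′ × cost S′ ≤ cost S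

  Easier-refl : ∀ {k r} → Easier k r r
  Easier-refl S sched = S , sched , ≤-refl

  Easier-trans : ∀ {k r₁ r₂ r₃} → Easier k r₁ r₂ → Easier k r₂ r₃ → Easier k r₁ r₃
  Easier-trans e₁₂ e₂₃ S sched with S₂ , sched₂ , le₂ ← e₂₃ S sched
    with S₁ , sched₁ , le₁ ← e₁₂ S₂ sched₂ = S₁ , sched₁ , ≤-trans le₁ le₂

  cost-++-∷ : ∀ (S : List (Subset N)) C S′ → cost (S ++ C ∷ S′) ≡ cost (S ++ [ C ]) + cost (C ∷ S′)
  cost-++-∷ []          C S′ = refl
  cost-++-∷ (D ∷ [])    C S′ = cong (_+ cost (C ∷ S′)) (sym (+-identityʳ ∣ D ─ C ∣))
  cost-++-∷ (D ∷ E ∷ S) C S′ = trans (cong (∣ D ─ E ∣ +_) (cost-++-∷ (E ∷ S) C S′))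
                                     (sym (+-assoc ∣ D ─ E ∣ (cost (E ∷ S ++ [ C ])) (cost (C ∷ S′))))

module Transposition {n : ℕ} (x y : Fin n) (x≢y : x ≢ y) where

  y≢x : y ≢ x
  y≢x = x≢y ∘ sym

  τ : Fin n → Fin n
  τ = transpose x y

  τ-x : τ x ≡ y
  τ-x rewrite dec-true (x ≟ x) refl = refl

  τ-y : τ y ≡ x
  τ-y rewrite dec-false (y ≟ x) y≢x | dec-true (y ≟ y) refl = refl

  τ-other : ∀ {i} → i ≢ x → i ≢ y → τ i ≡ i
  τ-other {i} i≢x i≢y rewrite dec-false (i ≟ x) i≢x | dec-false (i ≟ y) i≢y = refl

  data View : Fin n → Set where
    at-x : View x
    at-y : View y
    elsewhere : ∀ {i} → i ≢ x → i ≢ y → View i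

  view : ∀ i → View i
  view i with i ≟ x | i ≟ y
  ... | yes refl | _        = at-x
  ... | no _     | yes refl = at-y
  ... | no i≢x   | no i≢y   = elsewhere i≢x i≢y

  preimage-τ-as-updates : ∀ p → preimage τ p ≡ (p [ x ]≔ lookup p y) [ y ]≔ lookup p x
  preimage-τ-as-updates p = ≗-lookup⇒≡ λ i → trans (lookup-preimage τ p i) (pointwise i (view i))
    where
    pointwise : ∀ i → View i → lookup p (τ i) ≡ lookup ((p [ x ]≔ lookup p y) [ y ]≔ lookup p x) i
    pointwise _ at-x
      rewrite τ-x | lookup∘update′ x≢y (p [ x ]≔ lookup p y) (lookup p x)
            | lookup∘update x p (lookup p y) = refl
    pointwise _ at-y
      rewrite τ-y | lookup∘update y (p [ x ]≔ lookup p y) (lookup p x) = refl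
    pointwise i (elsewhere i≢x i≢y)
      rewrite τ-other i≢x i≢y | lookup∘update′ i≢y (p [ x ]≔ lookup p y) (lookup p x)
            | lookup∘update′ i≢x p (lookup p y) = refl

  ∣preimage-τ∣ : ∀ p → ∣ preimage τ p ∣ ≡ ∣ p ∣
  ∣preimage-τ∣ p = +-cancelʳ-≡ (bit (lookup p y)) ∣ preimage τ p ∣ ∣ p ∣ (begin
    ∣ preimage τ p ∣ + bit (lookup p y)
      ≡⟨ cong (λ u → ∣ u ∣ + bit (lookup p y)) (preimage-τ-as-updates p) ⟩
    ∣ w [ y ]≔ lookup p x ∣ + bit (lookup p y)
      ≡⟨ cong (λ b → ∣ w [ y ]≔ lookup p x ∣ + bit b) (lookup∘update′ y≢x p (lookup p y)) ⟨
    ∣ w [ y ]≔ lookup p x ∣ + bit (lookup w y)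
      ≡⟨ ∣p[i]≔b∣ w y (lookup p x) ⟩
    ∣ w ∣ + bit (lookup p x)
      ≡⟨ ∣p[i]≔b∣ p x (lookup p y) ⟩
    ∣ p ∣ + bit (lookup p y)
      ∎)
    where
    open ≡-Reasoning
    w : Subset n
    w = p [ x ]≔ lookup p y

  τ-involutive : ∀ i → τ (τ i) ≡ i
  τ-involutive i with view i
  ... | at-x = trans (cong τ τ-x) τ-y
  ... | at-y = trans (cong τ τ-y) τ-x
  ... | elsewhere i≢x i≢y = trans (cong τ (τ-other i≢x i≢y)) (τ-other i≢x i≢y)

  τ-injective : ∀ {i j} → τ i ≡ τ j → i ≡ j
  τ-injective {i} {j} eq = trans (sym (τ-involutive i)) (trans (cong τ eq) (τ-involutive j))

  preimage-τ-invariant : ∀ p → lookup p x ≡ lookup p y → preimage τ p ≡ p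
  preimage-τ-invariant p px≡py = preimage-invariant τ p λ i → pointwise i (view i)
    where
    pointwise : ∀ i → View i → lookup p (τ i) ≡ lookup p i
    pointwise _ at-x = trans (cong (lookup p) τ-x) (sym px≡py)
    pointwise _ at-y = trans (cong (lookup p) τ-y) px≡py
    pointwise _ (elsewhere i≢x i≢y) = cong (lookup p) (τ-other i≢x i≢y)

  ∣preimage-τ-─∣ : ∀ p q → ∣ preimage τ p ─ preimage τ q ∣ ≡ ∣ p ─ q ∣
  ∣preimage-τ-─∣ p q = trans (cong ∣_∣ (sym (preimage-─ τ p q))) (∣preimage-τ∣ (p ─ q))

  ∣─preimage-τ∣-≡ : ∀ p q → lookup p x ≡ true → lookup p y ≡ true →
    ∣ p ─ preimage τ q ∣ ≡ ∣ p ─ q ∣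
  ∣─preimage-τ∣-≡ p q px py = begin
    ∣ p ─ preimage τ q ∣
      ≡⟨ cong (λ u → ∣ u ─ preimage τ q ∣) (preimage-τ-invariant p (trans px (sym py))) ⟨
    ∣ preimage τ p ─ preimage τ q ∣
      ≡⟨ ∣preimage-τ-─∣ p q ⟩
    ∣ p ─ q ∣
      ∎
    where open ≡-Reasoning

  ∣─preimage-τ∣-≤ : ∀ p q → lookup p y ≡ true → lookup q y ≡ false →
    ∣ p ─ preimage τ q ∣ ≤ ∣ p ─ q ∣
  ∣─preimage-τ∣-≤ p q py qy with lookup q x in qx
  ... | false = ≤-reflexive (cong (λ u → ∣ p ─ u ∣) (preimage-τ-invariant q (trans qx (sym qy))))
  ... | true  = ≤-trans (lookup-⊆⇒∣p∣≤∣q∣ (p ─ preimage τ q) (preimage τ (p ─ q)) λ i → pointwise i (view i))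
                        (≤-reflexive (∣preimage-τ∣ (p ─ q)))
    where
    pointwise : ∀ i → View i →
      lookup (p ─ preimage τ q) i ≡ true → lookup (preimage τ (p ─ q)) i ≡ true
    pointwise _ at-x _
      rewrite lookup-preimage τ (p ─ q) x | τ-x | lookup-─ p q y | py | qy = refl
    pointwise _ at-y y∈
      rewrite lookup-─ p (preimage τ q) y | lookup-preimage τ q y | τ-y | qx | ∧-zeroʳ (lookup p y) =
      contradiction y∈ λ ()
    pointwise i (elsewhere i≢x i≢y) i∈
      rewrite lookup-preimage τ (p ─ q) i | lookup-─ p (preimage τ q) i | lookup-preimage τ q i
            | τ-other i≢x i≢y | lookup-─ p q i = i∈

  map-τ-fixed : ∀ L → x ∉ L → y ∉ L → map τ L ≡ L
  map-τ-fixed []      _   _   = refl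
  map-τ-fixed (u ∷ L) x∉L y∉L =
    cong₂ _∷_ (τ-other (x∉L ∘ here ∘ sym) (y∉L ∘ here ∘ sym))
              (map-τ-fixed L (x∉L ∘ there) (y∉L ∘ there))

  map-τ-++-∷ : ∀ L z s → x ∉ L → y ∉ L → map τ (L ++ z ∷ s) ≡ L ++ τ z ∷ map τ s
  map-τ-++-∷ L z s x∉L y∉L =
    trans (map-++ τ L (z ∷ s)) (cong (_++ τ z ∷ map τ s) (map-τ-fixed L x∉L y∉L))

  map-τ-++-x∷ : ∀ L s → x ∉ L → y ∉ L → map τ (L ++ x ∷ s) ≡ L ++ y ∷ map τ s
  map-τ-++-x∷ L s x∉L y∉L = trans (map-τ-++-∷ L x s x∉L y∉L) (cong (λ z → L ++ z ∷ map τ s) τ-x)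

  -- τ is an involution, so preimage τ C is also the τ-image of the cache C.
  IsSchedule-relabel : ∀ {k s S} → IsSchedule k s S → IsSchedule k (map τ s) (map (preimage τ) S)
  IsSchedule-relabel {k} = PW.map⁺ τ (preimage τ) ∘ PW.map relabel-request
    where
    relabel-request : ∀ {u C} → u ∈ₛ C × ∣ C ∣ ≤ k → τ u ∈ₛ preimage τ C × ∣ preimage τ C ∣ ≤ k
    relabel-request {u} {C} (u∈C , ∣C∣≤k) =
      lookup⇒[]= (τ u) (preimage τ C)
        (trans (lookup-preimage τ C (τ u)) (trans (cong (lookup C) (τ-involutive u)) ([]=⇒lookup u∈C))) ,
      subst (_≤ k) (sym (∣preimage-τ∣ C)) ∣C∣≤k

  cost-relabel : ∀ S → cost (map (preimage τ) S) ≡ cost S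
  cost-relabel []          = refl
  cost-relabel (C ∷ [])    = refl
  cost-relabel (C ∷ D ∷ S) = cong₂ _+_ (∣preimage-τ-─∣ C D) (cost-relabel (D ∷ S))

  cost-relabel-tail : ∀ C S → lookup C x ≡ true → lookup C y ≡ true →
    cost (C ∷ map (preimage τ) S) ≡ cost (C ∷ S)
  cost-relabel-tail C []      _  _  = refl
  cost-relabel-tail C (D ∷ S) Cx Cy = cong₂ _+_ (∣─preimage-τ∣-≡ C D Cx Cy) (cost-relabel (D ∷ S))

  Easier-relabel : ∀ {k} r → Easier k (map τ r) r
  Easier-relabel r S sched = map (preimage τ) S , IsSchedule-relabel sched , ≤-reflexive (cost-relabel S)

  -- Keep the caches of S while they hold y; from the first one that does not, or from the
  -- request of x on, continue with the τ-image of S.  The eviction into the first relabelled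
  -- cache does not grow since the cache before it holds y (and, at the request of x, also x).
  exchange : ∀ {k} p s C S → lookup C y ≡ true → x ∉ p → y ∉ p → IsSchedule k (p ++ x ∷ s) S →
    ∃ λ S′ → IsSchedule k (map τ (p ++ x ∷ s)) S′ × cost (C ∷ S′) ≤ cost (C ∷ S)
  exchange []      s C [] _ _ _ ()
  exchange (_ ∷ _) s C [] _ _ _ ()
  exchange p s C (D ∷ S) Cy x∉p y∉p sched with lookup D y in Dy
  ... | false = map (preimage τ) (D ∷ S) , IsSchedule-relabel sched ,
                +-mono-≤ (∣─preimage-τ∣-≤ C D Cy Dy) (≤-reflexive (cost-relabel (D ∷ S)))
  exchange [] s C (D ∷ S) Cy _ _ ((x∈D , ∣D∣≤k) ∷ sched) | true =
    D ∷ map (preimage τ) S ,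
    (subst (_∈ₛ D) (sym τ-x) (lookup⇒[]= y D Dy) , ∣D∣≤k) ∷ IsSchedule-relabel sched ,
    +-monoʳ-≤ ∣ C ─ D ∣ (≤-reflexive (cost-relabel-tail D S ([]=⇒lookup x∈D) Dy))
  exchange (u ∷ p) s C (D ∷ S) Cy x∉p y∉p ((u∈D , ∣D∣≤k) ∷ sched) | true
    with S′ , sched′ , le ← exchange p s D S Dy (x∉p ∘ there) (y∉p ∘ there) sched =
    D ∷ S′ ,
    (subst (_∈ₛ D) (sym (τ-other (x∉p ∘ here ∘ sym) (y∉p ∘ here ∘ sym))) u∈D , ∣D∣≤k) ∷ sched′ ,
    +-monoʳ-≤ ∣ C ─ D ∣ le

  Easier-exchange : ∀ {k} q p s → x ∉ p → y ∉ p →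
    Easier k (q ++ y ∷ p ++ y ∷ map τ s) (q ++ y ∷ p ++ x ∷ s)
  Easier-exchange {k} q p s x∉p y∉p S sched
    with Sq , D ∷ S₂ , refl , sched-q , (y∈D , ∣D∣≤k) ∷ sched₂ ← Pointwise-++⁻ q S sched
    with S₂′ , sched₂′ , le ← exchange p s D S₂ ([]=⇒lookup y∈D) x∉p y∉p sched₂ =
    Sq ++ D ∷ S₂′ ,
    PW.++⁺ sched-q ((y∈D , ∣D∣≤k) ∷ subst (λ r → IsSchedule k r S₂′) (map-τ-++-x∷ p s x∉p y∉p) sched₂′) ,
    (begin
      cost (Sq ++ D ∷ S₂′)                ≡⟨ cost-++-∷ Sq D S₂′ ⟩
      cost (Sq ++ [ D ]) + cost (D ∷ S₂′) ≤⟨ +-monoʳ-≤ (cost (Sq ++ [ D ])) le ⟩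
      cost (Sq ++ [ D ]) + cost (D ∷ S₂)  ≡⟨ cost-++-∷ Sq D S₂ ⟨
      cost (Sq ++ D ∷ S₂)                 ∎)
    where open ≤-Reasoning

module RankOrder {N : ℕ} (π : Permutation′ N) where

  open DecMembership (_≟_ {n = N}) using (_∈?_)

  without : Fin N → List (Fin N) → List (Fin N)
  without z = filter (¬? ∘ (z ≟_))

  moveToFront : Fin N → List (Fin N) → List (Fin N)
  moveToFront z O = z ∷ without z O

  without-fixed : ∀ {z} L → z ∉ L → without z L ≡ L
  without-fixed L z∉L = filter-all (¬? ∘ (_ ≟_)) (¬Any⇒All¬ L z∉L)

  without-++-∷ : ∀ {z} A B → z ∉ A → z ∉ B → without z (A ++ z ∷ B) ≡ A ++ B
  without-++-∷ {z} A B z∉A z∉B = begin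
    without z (A ++ z ∷ B)
      ≡⟨ filter-++ (¬? ∘ (z ≟_)) A (z ∷ B) ⟩
    without z A ++ without z (z ∷ B)
      ≡⟨ cong₂ _++_ (without-fixed A z∉A) (filter-reject (¬? ∘ (z ≟_)) (λ z≢z → z≢z refl)) ⟩
    A ++ without z B
      ≡⟨ cong (A ++_) (without-fixed B z∉B) ⟩
    A ++ B
      ∎
    where open ≡-Reasoning

  without-map : ∀ {σ} → Injective _≡_ _≡_ σ → ∀ z O → without (σ z) (map σ O) ≡ map σ (without z O)
  without-map         σ-inj z []      = refl
  without-map {σ = σ} σ-inj z (u ∷ O) with σ z ≟ σ u | z ≟ u
  ... | yes _     | yes _   = without-map σ-inj z O
  ... | yes σz≡σu | no z≢u  = contradiction (σ-inj σz≡σu) z≢u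
  ... | no σz≢σu  | yes z≡u = contradiction (cong σ z≡u) σz≢σu
  ... | no _      | no _    = cong (σ u ∷_) (without-map σ-inj z O)

  π-order : List (Fin N)
  π-order = map (π ⟨$⟩ʳ_) (allFin N)

  unrequested : List (Fin N) → List (Fin N)
  unrequested p = filter (λ x → ¬? (x ∈? p)) π-order

  unrequested-∷ʳ : ∀ p z → unrequested (p ++ [ z ]) ≡ without z (unrequested p)
  unrequested-∷ʳ p z =
    trans (filter-≐ (λ x → ¬? (x ∈? p ++ [ z ])) (¬? ∘ (z ≟_) ∩? λ x → ¬? (x ∈? p)) (to , from) π-order)
          (filter-∩ (¬? ∘ (z ≟_)) (λ x → ¬? (x ∈? p)) π-order)
    where
    to : ∀ {w} → w ∉ p ++ [ z ] → z ≢ w × w ∉ p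
    to w∉ = (λ z≡w → w∉ (∈-++⁺ʳ p (here (sym z≡w)))) , (λ w∈p → w∉ (∈-++⁺ˡ w∈p))
    from : ∀ {w} → z ≢ w × w ∉ p → w ∉ p ++ [ z ]
    from (z≢w , w∉p) w∈ with ∈-++⁻ p w∈
    ... | inj₁ w∈p        = w∉p w∈p
    ... | inj₂ (here w≡z) = z≢w (sym w≡z)

  rankOrder-∷ʳ : ∀ p z → rankOrder π (p ++ [ z ]) ≡ moveToFront z (rankOrder π p)
  rankOrder-∷ʳ p z = begin
    deduplicate _≟_ (reverse (p ++ [ z ])) ++ unrequested (p ++ [ z ])
      ≡⟨ cong (λ ys → deduplicate _≟_ ys ++ unrequested (p ++ [ z ])) (reverse-++ p [ z ]) ⟩
    z ∷ without z (deduplicate _≟_ (reverse p)) ++ unrequested (p ++ [ z ])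
      ≡⟨ cong (λ ys → z ∷ without z (deduplicate _≟_ (reverse p)) ++ ys) (unrequested-∷ʳ p z) ⟩
    z ∷ without z (deduplicate _≟_ (reverse p)) ++ without z (unrequested p)
      ≡⟨ cong (z ∷_) (filter-++ (¬? ∘ (z ≟_)) (deduplicate _≟_ (reverse p)) (unrequested p)) ⟨
    moveToFront z (rankOrder π p)
      ∎
    where open ≡-Reasoning

  IsEnumeration : List (Fin N) → Set
  IsEnumeration O = Unique O × (∀ w → w ∈ O)

  moveToFront-enumeration : ∀ z {O} → IsEnumeration O → IsEnumeration (moveToFront z O)
  moveToFront-enumeration z {O} (unique , complete) =
    all-filter (¬? ∘ (z ≟_)) O ∷ Unique.filter⁺ (¬? ∘ (z ≟_)) unique , complete′
    where
    complete′ : ∀ w → w ∈ moveToFront z O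
    complete′ w with z ≟ w
    ... | yes refl = here refl
    ... | no z≢w   = there (∈-filter⁺ (¬? ∘ (z ≟_)) (complete w) z≢w)

  rankOrder-[]-enumeration : IsEnumeration (rankOrder π [])
  rankOrder-[]-enumeration rewrite filter-all (λ x → ¬? (x ∈? [])) (All.universal (λ _ ()) π-order) =
    Unique.map⁺ (Injection.injective (Inverse⇒Injection π)) (Unique.allFin⁺ N) ,
    λ w → subst (_∈ π-order) (inverseʳ π) (∈-map⁺ (π ⟨$⟩ʳ_) (∈-allFin (π ⟨$⟩ˡ w)))

  rankOrder-enumeration : ∀ p → IsEnumeration (rankOrder π p)
  rankOrder-enumeration p = go (reverseView p)
    where
    go : ∀ {p} → Reverse p → IsEnumeration (rankOrder π p)
    go []             = rankOrder-[]-enumeration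
    go (q ∶ rq ∶ʳ z) = subst IsEnumeration (sym (rankOrder-∷ʳ q z)) (moveToFront-enumeration z (go rq))

  position-head : ∀ a L → position π a (a ∷ L) ≡ 1
  position-head a L with a ≟ a
  ... | yes _   = refl
  ... | no a≢a = contradiction refl a≢a

  position-tail : ∀ {a u} L → a ≢ u → position π a (u ∷ L) ≡ suc (position π a L)
  position-tail {a} {u} L a≢u with a ≟ u
  ... | yes a≡u = contradiction a≡u a≢u
  ... | no _    = refl

  position-suc : ∀ a O → ∃ λ m → position π a O ≡ suc m
  position-suc a []      = 0 , refl
  position-suc a (u ∷ O) with a ≟ u
  ... | yes _ = 0 , refl
  ... | no _  = position π a O , refl

  position-injective : ∀ {v w} O → v ∈ O → w ∈ O → position π v O ≡ position π w O → v ≡ w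
  position-injective {v} {w} (u ∷ O) v∈ w∈ eq with v ≟ u | w ≟ u
  ... | yes v≡u | yes w≡u = trans v≡u (sym w≡u)
  ... | yes _   | no _    with m , eq′ ← position-suc w O = contradiction (trans (suc-injective eq) eq′) λ ()
  position-injective {v} {w} (u ∷ O) v∈ w∈ eq | no _ | yes _ with m , eq′ ← position-suc v O =
    contradiction (trans (suc-injective (sym eq)) eq′) λ ()
  position-injective {v} {w} (u ∷ O) v∈ w∈ eq | no v≢u | no w≢u =
    position-injective O (tail v≢u v∈) (tail w≢u w∈) (suc-injective eq)

  position-map : ∀ {σ} → Injective _≡_ _≡_ σ → ∀ w O → position π (σ w) (map σ O) ≡ position π w O
  position-map         σ-inj w []      = refl
  position-map {σ = σ} σ-inj w (u ∷ O) with σ w ≟ σ u | w ≟ u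
  ... | yes _      | yes _   = refl
  ... | yes σw≡σu  | no w≢u  = contradiction (σ-inj σw≡σu) w≢u
  ... | no σw≢σu   | yes w≡u = contradiction (cong σ w≡u) σw≢σu
  ... | no _       | no _    = cong suc (position-map σ-inj w O)

  predecessor : ∀ {x} j O → Unique O → x ∈ O → position π x O ≡ suc (suc j) →
    ∃ λ A → ∃₂ λ y B → O ≡ A ++ y ∷ x ∷ B × position π y O ≡ suc j
  predecessor {x} j (u ∷ O) unique x∈ eq with x ≟ u
  ... | yes _  = contradiction eq λ ()
  predecessor {x} zero (u ∷ []) _ x∈ eq | no x≢u = contradiction (tail x≢u x∈) λ ()
  predecessor {x} zero (u ∷ v ∷ O) _ x∈ eq | no x≢u with x ≟ v
  ... | yes refl = [] , u , O , refl , position-head u (x ∷ O)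
  ... | no _ with m , eq′ ← position-suc x O =
    contradiction (trans (sym eq′) (suc-injective (suc-injective eq))) λ ()
  predecessor {x} (suc j) (u ∷ O) (u∉O ∷ unique) x∈ eq | no x≢u
    with A , y , B , refl , eqy ← predecessor j O unique (tail x≢u x∈) (suc-injective eq) =
    u ∷ A , y , B , refl , trans (position-tail (A ++ y ∷ x ∷ B) (u≢y ∘ sym)) (cong suc eqy)
    where
    u≢y : u ≢ y
    u≢y = All.lookup u∉O (∈-++⁺ʳ A (here refl))

  Precedes : List (Fin N) → Fin N → Fin N → Set
  Precedes O a b = position π a O < position π b O

  precedes-head : ∀ {a b} L → b ≢ a → Precedes (a ∷ L) a b
  precedes-head {a} {b} L b≢a rewrite position-head a L | position-tail L b≢a | proj₂ (position-suc b L) =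
    s≤s (s≤s z≤n)

  precedes-∷ : ∀ {a b u} L → a ≢ u → b ≢ u → Precedes L a b → Precedes (u ∷ L) a b
  precedes-∷ L a≢u b≢u a<b rewrite position-tail L a≢u | position-tail L b≢u = s≤s a<b

  without-precedes : ∀ {v a b} O → v ≢ a → v ≢ b → Precedes O a b → Precedes (without v O) a b
  without-precedes []                     _   _   (s≤s ())
  without-precedes {v} {a} {b} (u ∷ O) v≢a v≢b a<b with a ≟ u | b ≟ u
  ... | yes refl | yes refl = contradiction a<b (<-irrefl refl)
  ... | no _     | yes refl = contradiction a<b λ { (s≤s ()) }
  ... | yes refl | no b≢a   =
    subst (λ L → Precedes L a b) (sym (filter-accept (¬? ∘ (v ≟_)) v≢a)) (precedes-head (without v O) b≢a)
  ... | no a≢u   | no b≢u   = by-cases (v ≟ u)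
    where
    ih : Precedes (without v O) a b
    ih = without-precedes O v≢a v≢b (≤-pred a<b)
    by-cases : Dec (v ≡ u) → Precedes (without v (u ∷ O)) a b
    by-cases (yes v≡u) =
      subst (λ L → Precedes L a b) (sym (filter-reject (¬? ∘ (v ≟_)) (λ v≢u → v≢u v≡u))) ih
    by-cases (no v≢u)  =
      subst (λ L → Precedes L a b) (sym (filter-accept (¬? ∘ (v ≟_)) v≢u)) (precedes-∷ (without v O) a≢u b≢u ih)

  rankOrder-precedes-++ : ∀ {a b} p q → a ∉ q → b ∉ q →
    Precedes (rankOrder π p) a b → Precedes (rankOrder π (p ++ q)) a b
  rankOrder-precedes-++ p [] _ _ a<b rewrite ++-identityʳ p = a<b
  rankOrder-precedes-++ {a} {b} p (v ∷ q) a∉ b∉ a<b rewrite sym (++-assoc p [ v ] q) =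
    rankOrder-precedes-++ (p ++ [ v ]) q (a∉ ∘ there) (b∉ ∘ there)
      (subst (λ O → Precedes O a b) (sym (rankOrder-∷ʳ p v))
        (precedes-∷ (without v (rankOrder π p)) (a∉ ∘ here) (b∉ ∘ here)
          (without-precedes (rankOrder π p) (a∉ ∘ here ∘ sym) (b∉ ∘ here ∘ sym) a<b)))

  last-requested-precedes : ∀ {a b} p q → a ∉ q → b ∉ q → a ≢ b →
    Precedes (rankOrder π (p ++ a ∷ q)) a b
  last-requested-precedes {a} {b} p q a∉q b∉q a≢b =
    subst (λ r → Precedes (rankOrder π r) a b) (++-assoc p [ a ] q)
      (rankOrder-precedes-++ (p ++ [ a ]) q a∉q b∉q
        (subst (λ O → Precedes O a b) (sym (rankOrder-∷ʳ p a)) (precedes-head _ (a≢b ∘ sym))))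

  predecessor-history : ∀ {x y} p → x ≢ y → Precedes (rankOrder π p) y x →
    (x ∉ p × y ∉ p) ⊎ ∃₂ λ p₁ p₂ → p ≡ p₁ ++ y ∷ p₂ × x ∉ p₂ × y ∉ p₂
  predecessor-history {x} {y} p x≢y y<x with y ∈? p | x ∈? p
  ... | no y∉p | no x∉p = inj₁ (x∉p , y∉p)
  ... | no y∉p | yes x∈p with p₁ , p₂ , refl , x∉p₂ ← last-occurrence _≟_ p x∈p =
    contradiction (last-requested-precedes p₁ p₂ x∉p₂ (y∉p ∘ ∈-++⁺ʳ p₁ ∘ there) x≢y) (<-asym y<x)
  ... | yes y∈p | _ with p₁ , p₂ , refl , y∉p₂ ← last-occurrence _≟_ p y∈p with x ∈? p₂
  ...   | no x∉p₂  = inj₂ (p₁ , p₂ , refl , x∉p₂ , y∉p₂)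
  ...   | yes x∈p₂ with p₂₁ , p₂₂ , refl , x∉p₂₂ ← last-occurrence _≟_ p₂ x∈p₂ =
    contradiction (subst (λ r → Precedes (rankOrder π r) x y) (++-assoc p₁ (y ∷ p₂₁) (x ∷ p₂₂))
                    (last-requested-precedes (p₁ ++ y ∷ p₂₁) p₂₂ x∉p₂₂ (y∉p₂ ∘ ∈-++⁺ʳ p₂₁ ∘ there) x≢y))
                  (<-asym y<x)

  ranksFrom-map : ∀ {σ} → Injective _≡_ _≡_ σ → ∀ s {q q′} → rankOrder π q′ ≡ map σ (rankOrder π q) →
    ranksFrom π q′ (map σ s) ≡ ranksFrom π q s
  ranksFrom-map σ-inj []      eq = refl
  ranksFrom-map {σ} σ-inj (z ∷ s) {q} {q′} eq = cong₂ _∷_ same-rank (ranksFrom-map σ-inj s same-order)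
    where
    open ≡-Reasoning
    same-rank : rank π (σ z) q′ ≡ rank π z q
    same-rank = trans (cong (position π (σ z)) eq) (position-map σ-inj z (rankOrder π q))
    same-order : rankOrder π (q′ ++ [ σ z ]) ≡ map σ (rankOrder π (q ++ [ z ]))
    same-order = begin
      rankOrder π (q′ ++ [ σ z ])              ≡⟨ rankOrder-∷ʳ q′ (σ z) ⟩
      moveToFront (σ z) (rankOrder π q′)        ≡⟨ cong (moveToFront (σ z)) eq ⟩
      moveToFront (σ z) (map σ (rankOrder π q)) ≡⟨ cong (σ z ∷_) (without-map σ-inj z (rankOrder π q)) ⟩
      map σ (moveToFront z (rankOrder π q))     ≡⟨ cong (map σ) (rankOrder-∷ʳ q z) ⟨
      map σ (rankOrder π (q ++ [ z ]))          ∎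

  module _ {x y : Fin N} (x≢y : x ≢ y) where

    open Transposition x y x≢y

    moveToFront-swap : ∀ A B → x ∉ A → y ∉ A → x ∉ B → y ∉ B →
      moveToFront y (A ++ y ∷ x ∷ B) ≡ map τ (moveToFront x (A ++ y ∷ x ∷ B))
    moveToFront-swap A B x∉A y∉A x∉B y∉B = begin
      y ∷ without y (A ++ y ∷ x ∷ B)
        ≡⟨ cong (y ∷_) (without-++-∷ A (x ∷ B) y∉A y∉x∷B) ⟩
      y ∷ A ++ x ∷ B
        ≡⟨ cong₂ (λ z L → z ∷ A ++ L) τ-x (cong (_∷ B) τ-y) ⟨
      τ x ∷ A ++ τ y ∷ B
        ≡⟨ cong (λ L → τ x ∷ A ++ τ y ∷ L) (map-τ-fixed B x∉B y∉B) ⟨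
      τ x ∷ A ++ τ y ∷ map τ B
        ≡⟨ cong (τ x ∷_) (map-τ-++-∷ A y B x∉A y∉A) ⟨
      map τ (x ∷ A ++ y ∷ B)
        ≡⟨ cong (λ L → map τ (x ∷ L)) (++-assoc A [ y ] B) ⟨
      map τ (x ∷ (A ++ [ y ]) ++ B)
        ≡⟨ cong (λ L → map τ (x ∷ L)) (without-++-∷ (A ++ [ y ]) B x∉A∷ʳy x∉B) ⟨
      map τ (x ∷ without x ((A ++ [ y ]) ++ x ∷ B))
        ≡⟨ cong (λ L → map τ (x ∷ without x L)) (++-assoc A [ y ] (x ∷ B)) ⟩
      map τ (x ∷ without x (A ++ y ∷ x ∷ B))
        ∎
      where
      open ≡-Reasoning
      y∉x∷B : y ∉ x ∷ B
      y∉x∷B (here y≡x) = x≢y (sym y≡x)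
      y∉x∷B (there y∈B) = y∉B y∈B
      x∉A∷ʳy : x ∉ A ++ [ y ]
      x∉A∷ʳy x∈ with ∈-++⁻ A x∈
      ... | inj₁ x∈A        = x∉A x∈A
      ... | inj₂ (here x≡y) = x≢y x≡y

    rankOrder-swap : ∀ p A B → rankOrder π p ≡ A ++ y ∷ x ∷ B → x ∉ A → y ∉ A → x ∉ B → y ∉ B →
      rankOrder π (p ++ [ y ]) ≡ map τ (rankOrder π (p ++ [ x ]))
    rankOrder-swap p A B order x∉A y∉A x∉B y∉B = begin
      rankOrder π (p ++ [ y ])                ≡⟨ rankOrder-∷ʳ p y ⟩
      moveToFront y (rankOrder π p)           ≡⟨ cong (moveToFront y) order ⟩
      moveToFront y (A ++ y ∷ x ∷ B)          ≡⟨ moveToFront-swap A B x∉A y∉A x∉B y∉B ⟩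
      map τ (moveToFront x (A ++ y ∷ x ∷ B))  ≡⟨ cong (map τ ∘ moveToFront x) order ⟨
      map τ (moveToFront x (rankOrder π p))   ≡⟨ cong (map τ) (rankOrder-∷ʳ p x) ⟨
      map τ (rankOrder π (p ++ [ x ]))        ∎
      where open ≡-Reasoning

    Easier-swap : ∀ {k} p s → Precedes (rankOrder π p) y x → Easier k (p ++ y ∷ map τ s) (p ++ x ∷ s)
    Easier-swap {k} p s y<x with predecessor-history p x≢y y<x
    ... | inj₁ (x∉p , y∉p) =
      subst (λ r → Easier k r (p ++ x ∷ s)) (map-τ-++-x∷ p s x∉p y∉p) (Easier-relabel (p ++ x ∷ s))
    ... | inj₂ (p₁ , p₂ , refl , x∉p₂ , y∉p₂) =
      subst₂ (Easier k) (sym (++-assoc p₁ (y ∷ p₂) (y ∷ map τ s))) (sym (++-assoc p₁ (y ∷ p₂) (x ∷ s)))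
        (Easier-exchange p₁ p₂ s x∉p₂ y∉p₂)

  Replaceable : ℕ → List (Fin N) → Fin N → List (Fin N) → Fin N → Set
  Replaceable k p x s y = ∃ λ s′ →
    ranksFrom π (p ++ [ y ]) s′ ≡ ranksFrom π (p ++ [ x ]) s × Easier k (p ++ y ∷ s′) (p ++ x ∷ s)

  swap-with-predecessor : ∀ {k} p x s j → rank π x p ≡ suc (suc j) →
    ∃ λ y → rank π y p ≡ suc j × Replaceable k p x s y
  swap-with-predecessor p x s j x-rank
    with unique , complete ← rankOrder-enumeration p
    with A , y , B , order , y-rank ← predecessor j (rankOrder π p) unique (complete x) x-rank
    with x≢y , x∉A , y∉A , x∉B , y∉B ← Unique-adjacent A B (subst Unique order unique) =
    y , y-rank , map τ s ,
    ranksFrom-map τ-injective s (rankOrder-swap x≢y p A B order x∉A y∉A x∉B y∉B) ,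
    Easier-swap x≢y p s (subst₂ _<_ (sym y-rank) (sym x-rank) ≤-refl)
    where open Transposition x y x≢y

  lower-rank : ∀ {k} d p x s m → rank π x p ≡ d + suc m →
    ∃ λ y → rank π y p ≡ suc m × Replaceable k p x s y
  lower-rank zero    p x s m x-rank = x , x-rank , s , refl , Easier-refl
  lower-rank (suc d) p x s m x-rank
    with y₁ , y₁-rank , s₁ , ranks₁ , easier₁
           ← swap-with-predecessor p x s (d + m) (trans x-rank (cong suc (+-suc d m)))
    with y , y-rank , s′ , ranks , easier ← lower-rank d p y₁ s₁ m (trans y₁-rank (sym (+-suc d m))) =
    y , y-rank , s′ , trans ranks ranks₁ , Easier-trans easier easier₁

  ≥-ranks⇒Easier : ∀ {k} p r r′ → Pointwise _≥_ (ranksFrom π p r) (ranksFrom π p r′) →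
    Easier k (p ++ r′) (p ++ r)
  ≥-ranks⇒Easier p []      []        []             = Easier-refl
  ≥-ranks⇒Easier {k} p (x ∷ r) (x′ ∷ r′) (ρ≥ρ′ ∷ ranks≥)
    with _ , complete ← rankOrder-enumeration p
    with m , x′-rank ← position-suc x′ (rankOrder π p)
    with y , y-rank , s , same-ranks , easier
           ← lower-rank (rank π x p ∸ suc m) p x r m (sym (m∸n+n≡m (subst (_≤ rank π x p) x′-rank ρ≥ρ′)))
    with refl ← position-injective (rankOrder π p) (complete y) (complete x′) (trans y-rank (sym x′-rank)) =
    Easier-trans
      (subst₂ (Easier k) (++-assoc p [ x′ ] r′) (++-assoc p [ x′ ] s)
        (≥-ranks⇒Easier (p ++ [ x′ ]) s r′
          (subst (λ ρs → Pointwise _≥_ ρs (ranksFrom π (p ++ [ x′ ]) r′)) (sym same-ranks) ranks≥)))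
      easier

Easier⇒opt≤ : ∀ {N k} {r r′ : List (Fin N)} {c c′} → Easier k r′ r → IsOpt k r c → IsOpt k r′ c′ →
  c′ ≤ c
Easier⇒opt≤ easier ((S , sched , refl) , _) (_ , minimal′) with S′ , sched′ , S′≤S ← easier S sched =
  ≤-trans (minimal′ S′ sched′) S′≤S

-- The equal-length hypothesis is implied by the pointwise comparison of the ranks.
lemma8 : (N : ℕ) (π : Permutation′ N) (k : ℕ) (r r′ : List (Fin N))
    → length r ≡ length r′
    → Pointwise _≥_ (prefixRanks π r) (prefixRanks π r′)
    → (c c′ : ℕ) → IsOpt k r c → IsOpt k r′ c′
    → c′ ≤ c
lemma8 N π k r r′ _ ranks≥ c c′ = Easier⇒opt≤ (RankOrder.≥-ranks⇒Easier π [] r r′ ranks≥)
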